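{- Let $m\geq 3$ and let $\tau=(0\;3)(1\;2)$, a permutation of $\mathbb{Z}_4$. The graph $C_m\Box_\tau C_4$ is both $2$-spanning cyclable and $3$-spanning cyclable.
   Context: For a permutation $\tau$ of $\mathbb{Z}_n$, the graph $C_m\Box_\tau C_n$ is obtained from the Cartesian product $P_m\Box C_n$, with vertices $u_{i,j}$ ($0\le i\le m-1$, $j\in\mathbb{Z}_n$) and edges $[u_{i,j},u_{i,j+1}]$ for all $i,j$ and $[u_{i,j},u_{i+1,j}]$ for $0\le i\le m-2$, by adding the edges $[u_{m-1,j},u_{0,\tau(j)}]$ for all $j$. A 2-factor of a graph is a spanning subgraph in which every vertex has valency 2; it separates a set $A$ of $k$ vertices if it consists of exactly $k$ cycles and $A$ meets the vertex set of each cycle in exactly one vertex. A graph $X$ is $k$-spanning cyclable if for every $A\subseteq V(X)$ with $|A|=k$ there is a 2-factor of $X$ separating $A$. -}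

module Defs where

open import Data.Nat using (ℕ; zero; suc; _%_; NonZero)
open import Data.Fin using (Fin; toℕ; zero; suc)
open import Data.Bool using (Bool; true)
open import Data.Product using (_×_; _,_; ∃; ∃-syntax)
open import Data.Sum using (_⊎_)
open import Relation.Binary.PropositionalEquality using (_≡_)
open import Relation.Binary.Construct.Closure.ReflexiveTransitive using (Star)
open import Relation.Nullary using (¬_)
open import Function.Definitions using (Injective)
open import Function.Bundles using (_↔_)

Vtx : ℕ → ℕ → Set
Vtx m n = Fin m × Fin n

-- Directed generating edges of C_m □_τ C_n (each edge listed in one orientation).
data Edge (m n : ℕ) .{{_ : NonZero n}} (τ : Fin n → Fin n) : Vtx m n → Vtx m n → Set where
  horiz : ∀ (i : Fin m) (j j′ : Fin n) → toℕ j′ ≡ suc (toℕ j) % n → Edge m n τ (i , j) (i , j′)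
  vert  : ∀ (i i′ : Fin m) (j : Fin n) → toℕ i′ ≡ suc (toℕ i) → Edge m n τ (i , j) (i′ , j)
  twist : ∀ (i i′ : Fin m) (j : Fin n) → suc (toℕ i) ≡ m → toℕ i′ ≡ 0 → Edge m n τ (i , j) (i′ , τ j)

Adj : (m n : ℕ) .{{_ : NonZero n}} (τ : Fin n → Fin n) → Vtx m n → Vtx m n → Set
Adj m n τ x y = Edge m n τ x y ⊎ Edge m n τ y x

record Is2Factor (m n : ℕ) .{{_ : NonZero n}} (τ : Fin n → Fin n)
                 (F : Vtx m n → Vtx m n → Bool) : Set where
  field
    symm     : ∀ x y → F x y ≡ true → F y x ≡ true
    subgraph : ∀ x y → F x y ≡ true → Adj m n τ x y
    degree2  : ∀ x → ∃[ y ] ∃[ z ] (¬ y ≡ z × F x y ≡ true × F x z ≡ true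
                 × (∀ w → F x w ≡ true → w ≡ y ⊎ w ≡ z))

Conn : ∀ {m n} → (Vtx m n → Vtx m n → Bool) → Vtx m n → Vtx m n → Set
Conn F = Star (λ x y → F x y ≡ true)

-- F separates the k-set A = {a 0, …, a (k-1)} (a injective): every cycle
-- (connected component) of F meets A in exactly one vertex, i.e. every vertex
-- lies in the component of some a i, and distinct a i lie in distinct
-- components.  (Hence F has exactly k cycles.)
Separates : ∀ {m n k} → (Vtx m n → Vtx m n → Bool) → (Fin k → Vtx m n) → Set
Separates F a = (∀ v → ∃[ i ] Conn F (a i) v)
              × (∀ i i′ → Conn F (a i) (a i′) → i ≡ i′)

SpanningCyclable : (m n : ℕ) .{{_ : NonZero n}} (τ : Fin n → Fin n) → ℕ → Set
SpanningCyclable m n τ k =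
  (a : Fin k → Vtx m n) → Injective _≡_ _≡_ a →
  ∃[ F ] (Is2Factor m n τ F × Separates F a)

τ₀ : Fin 4 → Fin 4
τ₀ zero = suc (suc (suc zero))
τ₀ (suc zero) = suc (suc zero)
τ₀ (suc (suc zero)) = suc zero
τ₀ (suc (suc (suc zero))) = zero

{-# OPTIONS --safe #-}
module Submission where

open import Defs
open import Data.Bool using (Bool; true; if_then_else_)
open import Data.Empty using (⊥-elim)
open import Data.Fin using (Fin; zero; suc; toℕ; fromℕ; inject₁; punchOut; splitAt; _↑ˡ_; _↑ʳ_)
open import Data.Fin.Patterns using (0F; 1F; 2F; 3F)
open import Data.Fin.Permutation using (Permutation′; _⟨$⟩ʳ_; _⟨$⟩ˡ_; inverseʳ; transpose)
open import Data.Fin.Properties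
  using (all?; any?; injective⇒≤; punchOut-injective; *↔×; toℕ<n; toℕ-fromℕ<; toℕ-injective;
         toℕ-inject₁; toℕ-fromℕ; splitAt-↑ˡ; splitAt-↑ʳ; ↑ˡ-injective; ↑ʳ-injective)
  renaming (_≟_ to _≟ᶠ_)
open import Data.Fin.Relation.Unary.Top using (view; ‵fromℕ; ‵inject₁; view-fromℕ; view-inject₁)
open import Data.List using (List; []; _∷_; _++_; [_]; length; initLast; _∷ʳ′_; reverse; concat; tabulate; lookup)
open import Data.List.Membership.Propositional using (_∈_; _∉_)
open import Data.List.Membership.Propositional.Properties using (∈-++⁺ˡ; ∈-++⁺ʳ; ∈-++⁻)
open import Data.List.Properties using (++-assoc; ++-identityʳ; unfold-reverse; length-++; length-++-sucʳ; length-reverse)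
open import Data.List.Relation.Binary.Infix.Heterogeneous using (Infix; here; there; _++ⁱ_; _ⁱ++_)
open import Data.List.Relation.Binary.Infix.Heterogeneous.Properties using (infix?)
open import Data.List.Relation.Binary.Prefix.Heterogeneous using (Prefix; []; _∷_)
open import Data.List.Relation.Unary.All as All using ()
open import Data.List.Relation.Unary.All.Properties using (All¬⇒¬Any; ¬Any⇒All¬; ++⁻ˡ; ++⁻ʳ)
open import Data.List.Relation.Unary.Any using (here; there; index)
open import Data.List.Relation.Unary.Any.Properties using (lookup-index; reverse⁺)
open import Data.List.Relation.Unary.Unique.Propositional using (Unique; []; _∷_)
open import Data.List.Relation.Unary.Unique.Propositional.Properties using (Unique[x∷xs]⇒x∉xs; ++⁺)
open import Data.Nat using (ℕ; zero; suc; _+_; _∸_; _*_; _%_; _≤_; _<_; _≥_; _≰_; _≤?_; z≤n; s≤s; NonZero)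
import Data.Nat as ℕ
open import Data.Nat.DivMod using (_mod_; m<n⇒m%n≡m)
open import Data.Nat.Properties
  using (<-cmp; <-irrefl; <-trans; <-≤-trans; m<m+n; <⇒≤; <⇒≱; ≤-antisym; ≤-pred; ≤-refl; ≤-reflexive; ≤-trans; ≤∧≢⇒<; ≰⇒>;
         1+n≰n; n<1+n; n≤1+n; m≤m+n; m≤n+m; m≤n+m∸n; m≤m*n; m+[n∸m]≡n; m∸n+n≡m; m<n⇒0<n∸m;
         suc-injective; +-identityʳ; +-suc; +-mono-≤; *-comm; *-zeroʳ; *-distribˡ-+)
open import Data.Nat.Tactic.RingSolver using (solve-∀)
open import Data.Product using (∃; ∃₂; ∃-syntax; _×_; _,_; proj₁; proj₂)
open import Data.Product.Properties using (≡-dec)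
open import Data.Sum as Sum using (_⊎_; inj₁; inj₂; map₁; swap; [_,_]′)
open import Function using (_∘_; id)
open import Function.Bundles using (_↔_; Inverse; Injection; Equivalence; mk↔ₛ′; _⇔_; mk⇔)
open import Function.Consequences.Propositional using (contraInjective)
open import Function.Definitions using (Injective; Surjective)
open import Function.Properties.Equivalence using () renaming (trans to ⇔-trans)
open import Function.Properties.Inverse using (↔-refl; ↔-trans; ↔⇒↣)
open import Relation.Binary.Construct.Closure.ReflexiveTransitive as Star using (Star; ε; _◅_; _◅◅_; gmap)
open import Relation.Binary.Definitions using (DecidableEquality; tri<; tri≈; tri>)
open import Relation.Binary.PropositionalEquality
  using (_≡_; _≢_; refl; sym; trans; cong; cong₂; subst; subst₂; module ≡-Reasoning)
open import Relation.Nullary using (Dec; yes; no; does; ¬?)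
open import Relation.Nullary.Decidable using (dec-true; dec-false; from-yes; _→-dec_; _⊎-dec_; _×-dec_)

-- A 2-factor separating k vertices is assembled from k explicit cycles, listed as vertex lists, that
-- together cover every vertex and have total length 4m; by counting, the cycles are vertex-disjoint,
-- so consecutive vertices of the lists form a 2-factor whose components are exactly these cycles.
-- Two symmetries normalise the prescribed vertices: the row shift, which crosses the twisted edges,
-- and the symmetries of C₄ commuting with τ.  Vertices in distinct rows are separated by horizontal
-- bands of rows, each traversed by one snake-shaped cycle.  Two vertices of one row are separated by
-- splitting the columns into two adjacent pairs, each carrying a rectangle.  For a pair in one row and
-- a third vertex, the third vertex is shifted into the last row, which becomes a 4-cycle of its own
-- next to two rectangles on the other rows.  Three vertices of one row are moved to the last row with
-- column 3 empty; two cycles wrap around through the twisted edges and a third takes the rest.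

-- Cycles as vertex lists

ExactlyTwo : {A : Set} → (A → Set) → Set
ExactlyTwo P = ∃₂ λ y z → y ≢ z × P y × P z × (∀ w → P w → w ≡ y ⊎ w ≡ z)

ExactlyTwo-↔ : ∀ {A B : Set} {P : A → Set} (φ : B ↔ A) → ExactlyTwo P → ExactlyTwo (P ∘ Inverse.to φ)
ExactlyTwo-↔ {P = P} φ (y , z , y≢z , py , pz , only) =
  from y , from z , y≢z ∘ from-injective , subst P (sym (strictlyInverseˡ y)) py ,
  subst P (sym (strictlyInverseˡ z)) pz , λ w pw → Sum.map (to-from w) (to-from w) (only (to w) pw)
  where
  open Inverse φ
  from-injective : ∀ {u u′} → from u ≡ from u′ → u ≡ u′
  from-injective {u} {u′} eq = trans (sym (strictlyInverseˡ u)) (trans (cong to eq) (strictlyInverseˡ u′))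
  to-from : ∀ w {u} → to w ≡ u → w ≡ from u
  to-from w refl = sym (strictlyInverseʳ w)

ExactlyTwo-map : ∀ {A : Set} {P Q : A → Set} → (∀ {w} → P w → Q w) → (∀ {w} → Q w → P w) →
                 ExactlyTwo P → ExactlyTwo Q
ExactlyTwo-map P⇒Q Q⇒P (y , z , y≢z , py , pz , only) = y , z , y≢z , P⇒Q py , P⇒Q pz , λ w → only w ∘ Q⇒P

module _ {A : Set} where

  Consecutive : A → A → List A → Set
  Consecutive x y = Infix _≡_ (x ∷ y ∷ [])

  closed : List A → List A
  closed []       = []
  closed (x ∷ xs) = x ∷ xs ++ [ x ]

  CycleNeighbour : List A → A → A → Set
  CycleNeighbour xs x y = Consecutive x y (closed xs) ⊎ Consecutive y x (closed xs)

  consecutive-head : ∀ {x y xs} → Consecutive x y (x ∷ y ∷ xs)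
  consecutive-head = here (refl ∷ refl ∷ [])

  consecutive-∈ˡ : ∀ {x y xs} → Consecutive x y xs → x ∈ xs
  consecutive-∈ˡ (here (refl ∷ _)) = here refl
  consecutive-∈ˡ (there c)         = there (consecutive-∈ˡ c)

  consecutive-∈ʳ : ∀ {x y xs} → Consecutive x y xs → y ∈ xs
  consecutive-∈ʳ (here (_ ∷ refl ∷ [])) = there (here refl)
  consecutive-∈ʳ (there c)              = there (consecutive-∈ʳ c)

  ∈-closed⁻ : ∀ {v} xs → v ∈ closed xs → v ∈ xs
  ∈-closed⁻ (x ∷ xs) (here refl) = here refl
  ∈-closed⁻ (x ∷ xs) (there v∈) with ∈-++⁻ xs v∈
  ... | inj₁ v∈xs        = there v∈xs
  ... | inj₂ (here refl) = here refl

  cycle-neighbour-∈ : ∀ {xs x y} → CycleNeighbour xs x y → y ∈ xs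
  cycle-neighbour-∈ {xs} (inj₁ c) = ∈-closed⁻ xs (consecutive-∈ʳ c)
  cycle-neighbour-∈ {xs} (inj₂ c) = ∈-closed⁻ xs (consecutive-∈ˡ c)

  consecutive-∷ʳ-∈ˡ : ∀ {x y z} xs → Consecutive x y (xs ++ [ z ]) → x ∈ xs
  consecutive-∷ʳ-∈ˡ []       (here (_ ∷ ()))
  consecutive-∷ʳ-∈ˡ []       (there (here ()))
  consecutive-∷ʳ-∈ˡ (_ ∷ _)  (here (refl ∷ _)) = here refl
  consecutive-∷ʳ-∈ˡ (_ ∷ xs) (there c)         = there (consecutive-∷ʳ-∈ˡ xs c)

  consecutive-∷-∈ʳ : ∀ {x y z ys} → Consecutive x y (z ∷ ys) → y ∈ ys
  consecutive-∷-∈ʳ               (here (_ ∷ e ∷ [])) = here e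
  consecutive-∷-∈ʳ {ys = []}    (there (here ()))
  consecutive-∷-∈ʳ {ys = _ ∷ _} (there c)           = there (consecutive-∷-∈ʳ c)

  successor-unique : ∀ {x y y′ z xs} → Unique xs →
                     Consecutive x y (xs ++ [ z ]) → Consecutive x y′ (xs ++ [ z ]) → y ≡ y′
  successor-unique {xs = []} _ (here (_ ∷ ())) _
  successor-unique {xs = []} _ (there (here ())) _
  successor-unique {xs = _ ∷ _} _ (here (_ ∷ p)) (here (_ ∷ p′)) = same-head p p′
    where
    same-head : ∀ {y y′ l} → Prefix _≡_ (y ∷ []) l → Prefix _≡_ (y′ ∷ []) l → y ≡ y′
    same-head (e ∷ []) (e′ ∷ []) = trans e (sym e′)
  successor-unique {xs = _ ∷ xs} u (here (refl ∷ _)) (there c′) =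
    ⊥-elim (Unique[x∷xs]⇒x∉xs u (consecutive-∷ʳ-∈ˡ xs c′))
  successor-unique {xs = _ ∷ xs} u (there c) (here (refl ∷ _)) =
    ⊥-elim (Unique[x∷xs]⇒x∉xs u (consecutive-∷ʳ-∈ˡ xs c))
  successor-unique (_ ∷ u) (there c) (there c′) = successor-unique u c c′

  predecessor-unique : ∀ {x y y′ z ys} → Unique ys →
                       Consecutive y x (z ∷ ys) → Consecutive y′ x (z ∷ ys) → y ≡ y′
  predecessor-unique _ (here (e ∷ _)) (here (e′ ∷ _)) = trans e (sym e′)
  predecessor-unique u (here (_ ∷ refl ∷ [])) (there c′) = ⊥-elim (Unique[x∷xs]⇒x∉xs u (consecutive-∷-∈ʳ c′))
  predecessor-unique u (there c) (here (_ ∷ refl ∷ [])) = ⊥-elim (Unique[x∷xs]⇒x∉xs u (consecutive-∷-∈ʳ c))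
  predecessor-unique {ys = []} _ (there (here ())) _
  predecessor-unique {ys = _ ∷ _} (_ ∷ u) (there c) (there c′) = predecessor-unique u c c′

  private
    rotate-unique : ∀ {h : A} {t} → Unique (h ∷ t) → Unique (t ++ [ h ])
    rotate-unique (h∉t ∷ u) = ++⁺ u (All.[] ∷ []) λ { (v∈t , here refl) → All¬⇒¬Any h∉t v∈t }

    head-neighbours : ∀ {h t} → Unique (h ∷ t) → 2 ≤ length t →
      ∃₂ λ p s → p ≢ s × Consecutive p h (closed (h ∷ t)) × Consecutive h s (closed (h ∷ t))
    head-neighbours {h} {b ∷ t} u len with initLast t
    head-neighbours {h} {b ∷ .[]} u (s≤s ()) | []
    head-neighbours {h} {b ∷ .(us ++ [ z ])} (_ ∷ u) _ | us ∷ʳ′ z =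
      z , b , z≢b , subst (Consecutive z h) (cong (λ l → h ∷ b ∷ l) (sym (++-assoc us [ z ] [ h ])))
                          ((h ∷ b ∷ us) ++ⁱ consecutive-head) , consecutive-head
      where
      z≢b : z ≢ b
      z≢b refl = Unique[x∷xs]⇒x∉xs u (∈-++⁺ʳ us (here refl))

    -- The closing vertex c need not be h; the side condition excludes the degenerate cycle h x h.
    inner-neighbours : ∀ {h c x t} → Unique (h ∷ t) → c ∉ t → c ≢ h ⊎ 2 ≤ length t → x ∈ t →
      ∃₂ λ p s → p ≢ s × Consecutive p x (h ∷ t ++ [ c ]) × Consecutive x s (h ∷ t ++ [ c ])
    inner-neighbours {t = _ ∷ []} _ _ (inj₁ c≢h) (here refl) =
      _ , _ , c≢h ∘ sym , consecutive-head , there consecutive-head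
    inner-neighbours {t = _ ∷ []} _ _ (inj₂ (s≤s ())) (here refl)
    inner-neighbours {t = _ ∷ _ ∷ _} u _ _ (here refl) =
      _ , _ , (λ { refl → Unique[x∷xs]⇒x∉xs u (there (here refl)) }) , consecutive-head , there consecutive-head
    inner-neighbours {t = _ ∷ _} (_ ∷ u) c∉t _ (there x∈t)
      with p , s , p≢s , cp , cs ← inner-neighbours u (c∉t ∘ there) (inj₁ (c∉t ∘ here)) x∈t =
      p , s , p≢s , there cp , there cs

    neighbours-in-cycle : ∀ {h t x} → Unique (h ∷ t) → 2 ≤ length t → x ∈ h ∷ t →
      ∃₂ λ p s → p ≢ s × Consecutive p x (closed (h ∷ t)) × Consecutive x s (closed (h ∷ t))
    neighbours-in-cycle u len (here refl) = head-neighbours u len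
    neighbours-in-cycle u len (there x∈t) = inner-neighbours u (Unique[x∷xs]⇒x∉xs u) (inj₂ len) x∈t

  cycle-neighbours : ∀ {xs x} → Unique xs → 3 ≤ length xs → x ∈ xs → ExactlyTwo (CycleNeighbour xs x)
  cycle-neighbours {h ∷ t} {x} u (s≤s len) x∈xs = two (neighbours-in-cycle u len x∈xs)
    where
    two : ∃₂ (λ p s → p ≢ s × Consecutive p x (closed (h ∷ t)) × Consecutive x s (closed (h ∷ t))) →
          ExactlyTwo (CycleNeighbour (h ∷ t) x)
    two (p , s , p≢s , cp , cs) = s , p , p≢s ∘ sym , inj₁ cs , inj₂ cp , λ where
      w (inj₁ c) → inj₁ (successor-unique u c cs)
      w (inj₂ c) → inj₂ (predecessor-unique (rotate-unique u) c cp)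

  consecutive-reachable : ∀ {x v xs} → v ∈ x ∷ xs → Star (λ a b → Consecutive a b (x ∷ xs)) x v
  consecutive-reachable              (here refl)  = ε
  consecutive-reachable {xs = _ ∷ _} (there v∈xs) =
    consecutive-head ◅ gmap id there (consecutive-reachable v∈xs)

data Path {A : Set} (R : A → A → Set) : A → List A → A → Set where
  [_]ᵖ : ∀ x → Path R x [ x ] x
  _∷_  : ∀ {x y xs z} → R x y → Path R y xs z → Path R x (x ∷ xs) z

module _ {A : Set} {R : A → A → Set} where

  path-++ : ∀ {x y y′ z xs ys} → Path R x xs y → R y y′ → Path R y′ ys z → Path R x (xs ++ ys) z
  path-++ [ x ]ᵖ   r q = r ∷ q
  path-++ (r′ ∷ p) r q = r′ ∷ path-++ p r q

  path-reverse : (∀ {a b} → R a b → R b a) → ∀ {x xs z} → Path R x xs z → Path R z (reverse xs) x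
  path-reverse R-sym [ x ]ᵖ = [ x ]ᵖ
  path-reverse R-sym {x} {x ∷ xs} (r ∷ p) =
    subst (λ l → Path R _ l x) (sym (unfold-reverse x xs)) (path-++ (path-reverse R-sym p) (R-sym r) [ x ]ᵖ)

  path-reachable : ∀ {x xs z v} → Path R x xs z → v ∈ xs → Star (λ a b → Consecutive a b (closed xs)) x v
  path-reachable     [ x ]ᵖ  v∈ = gmap id (_ⁱ++ [ x ]) (consecutive-reachable v∈)
  path-reachable {x} (_ ∷ _) v∈ = gmap id (_ⁱ++ [ x ]) (consecutive-reachable v∈)

  path-consecutive : ∀ {x xs z w a b} → Path R x xs z → R z w → Consecutive a b (xs ++ [ w ]) → R a b
  path-consecutive [ x ]ᵖ         r (here (refl ∷ refl ∷ [])) = r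
  path-consecutive [ x ]ᵖ         r (there (here (_ ∷ ())))
  path-consecutive [ x ]ᵖ         r (there (there (here ())))
  path-consecutive (r′ ∷ [ y ]ᵖ)  r (here (refl ∷ refl ∷ [])) = r′
  path-consecutive (r′ ∷ (_ ∷ _)) r (here (refl ∷ refl ∷ [])) = r′
  path-consecutive (_ ∷ p)        r (there c) = path-consecutive p r c

  cycle-consecutive : ∀ {x xs z a b} → Path R x xs z → R z x → Consecutive a b (closed xs) → R a b
  cycle-consecutive p@([ _ ]ᵖ) = path-consecutive p
  cycle-consecutive p@(_ ∷ _)  = path-consecutive p

module _ {A : Set} where

  unique-++⁻ˡ : ∀ (xs : List A) {ys} → Unique (xs ++ ys) → Unique xs
  unique-++⁻ˡ []       _        = []
  unique-++⁻ˡ (x ∷ xs) (x∉ ∷ u) = ++⁻ˡ xs x∉ ∷ unique-++⁻ˡ xs u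

  unique-++⁻ʳ : ∀ (xs : List A) {ys} → Unique (xs ++ ys) → Unique ys
  unique-++⁻ʳ []       u       = u
  unique-++⁻ʳ (x ∷ xs) (_ ∷ u) = unique-++⁻ʳ xs u

  unique-++⇒disjoint : ∀ (xs : List A) {ys v} → Unique (xs ++ ys) → v ∈ xs → v ∉ ys
  unique-++⇒disjoint (x ∷ xs) (x∉ ∷ _) (here refl) = All¬⇒¬Any (++⁻ʳ xs x∉)
  unique-++⇒disjoint (x ∷ xs) (_ ∷ u)  (there v∈xs) = unique-++⇒disjoint xs u v∈xs

  ∈-concat-tabulate : ∀ {k} (f : Fin k → List A) c {v} → v ∈ f c → v ∈ concat (tabulate f)
  ∈-concat-tabulate f zero    v∈ = ∈-++⁺ˡ v∈
  ∈-concat-tabulate f (suc c) v∈ = ∈-++⁺ʳ (f zero) (∈-concat-tabulate (f ∘ suc) c v∈)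

  unique-concat-tabulate⁻ : ∀ {k} (f : Fin k → List A) → Unique (concat (tabulate f)) → ∀ c → Unique (f c)
  unique-concat-tabulate⁻ f u zero    = unique-++⁻ˡ (f zero) u
  unique-concat-tabulate⁻ f u (suc c) = unique-concat-tabulate⁻ (f ∘ suc) (unique-++⁻ʳ (f zero) u) c

  unique-concat-tabulate⇒disjoint : ∀ {k} (f : Fin k → List A) → Unique (concat (tabulate f)) →
                                     ∀ c c′ {v} → v ∈ f c → v ∈ f c′ → c ≡ c′
  unique-concat-tabulate⇒disjoint f u zero    zero     _  _   = refl
  unique-concat-tabulate⇒disjoint f u zero    (suc c′) v∈ v∈′ =
    ⊥-elim (unique-++⇒disjoint (f zero) u v∈ (∈-concat-tabulate (f ∘ suc) c′ v∈′))
  unique-concat-tabulate⇒disjoint f u (suc c) zero     v∈ v∈′ =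
    ⊥-elim (unique-++⇒disjoint (f zero) u v∈′ (∈-concat-tabulate (f ∘ suc) c v∈))
  unique-concat-tabulate⇒disjoint f u (suc c) (suc c′) v∈ v∈′ =
    cong suc (unique-concat-tabulate⇒disjoint (f ∘ suc) (unique-++⁻ʳ (f zero) u) c c′ v∈ v∈′)

  concat-tabulate-splitAt : ∀ k₁ {k₂} (h : Fin k₁ ⊎ Fin k₂ → List A) →
    concat (tabulate (h ∘ splitAt k₁)) ≡ concat (tabulate (h ∘ inj₁)) ++ concat (tabulate (h ∘ inj₂))
  concat-tabulate-splitAt zero    h = refl
  concat-tabulate-splitAt (suc k) h =
    trans (cong (h (inj₁ zero) ++_) (concat-tabulate-splitAt k (h ∘ map₁ suc))) (sym (++-assoc (h (inj₁ zero)) _ _))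

module _ {A : Set} (_≟_ : DecidableEquality A) where

  open import Data.List.Membership.DecPropositional _≟_ using (_∈?_)

  unique-or-duplicate : ∀ (xs : List A) → Unique xs ⊎ ∃₂ λ us ws → ∃ λ x → xs ≡ us ++ x ∷ ws × x ∈ ws
  unique-or-duplicate []       = inj₁ []
  unique-or-duplicate (x ∷ xs) with x ∈? xs | unique-or-duplicate xs
  ... | yes x∈xs | _  = inj₂ ([] , xs , x , refl , x∈xs)
  ... | no x∉xs  | inj₁ u = inj₁ (¬Any⇒All¬ xs x∉xs ∷ u)
  ... | no _     | inj₂ (us , ws , y , refl , y∈ws) = inj₂ (x ∷ us , ws , y , refl , y∈ws)

  covering-length : ∀ {N} {e : Fin N → A} → Injective _≡_ _≡_ e → ∀ {xs} → (∀ v → v ∈ xs) → N ≤ length xs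
  covering-length {e = e} e-inj {xs} covers = injective⇒≤ position-injective
    where
    position-injective : Injective _≡_ _≡_ (λ i → index (covers (e i)))
    position-injective {i} {j} eq = e-inj (begin
      e i                                   ≡⟨ lookup-index (covers (e i)) ⟩
      lookup xs (index (covers (e i)))      ≡⟨ cong (lookup xs) eq ⟩
      lookup xs (index (covers (e j)))      ≡⟨ lookup-index (covers (e j)) ⟨
      e j                                   ∎)
      where open ≡-Reasoning

  covering-unique : ∀ {N} {e : Fin N → A} → Injective _≡_ _≡_ e →
                    ∀ xs → (∀ v → v ∈ xs) → length xs ≤ N → Unique xs
  covering-unique e-inj xs covers short with unique-or-duplicate xs
  ... | inj₁ u = u
  ... | inj₂ (us , ws , x , refl , x∈ws) =
    ⊥-elim (<-irrefl refl (≤-trans (≤-trans (≤-reflexive (sym (length-++-sucʳ us x ws))) short)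
                                   (covering-length e-inj covers′)))
    where
    covers′ : ∀ v → v ∈ us ++ ws
    covers′ v with ∈-++⁻ us (covers v)
    ... | inj₁ v∈us         = ∈-++⁺ˡ v∈us
    ... | inj₂ (here refl)  = ∈-++⁺ʳ us x∈ws
    ... | inj₂ (there v∈ws) = ∈-++⁺ʳ us v∈ws

injective⇒surjective : ∀ {k} {f : Fin k → Fin k} → Injective _≡_ _≡_ f → Surjective _≡_ _≡_ f
injective⇒surjective {suc k} {f} f-inj c with any? (λ i → f i ≟ᶠ c)
... | yes (i , fi≡c) = i , λ { refl → fi≡c }
... | no no-preimage = ⊥-elim (<-irrefl refl (injective⇒≤ squeezed-injective))
  where
  c≢f : ∀ i → c ≢ f i
  c≢f i c≡fi = no-preimage (i , sym c≡fi)
  squeezed-injective : Injective _≡_ _≡_ (λ i → punchOut (c≢f i))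
  squeezed-injective eq = f-inj (punchOut-injective (c≢f _) (c≢f _) eq)

injective₂ : ∀ {A : Set} {f : Fin 2 → A} → f 0F ≢ f 1F → Injective _≡_ _≡_ f
injective₂ _   {0F} {0F} _  = refl
injective₂ f01 {0F} {1F} eq = ⊥-elim (f01 eq)
injective₂ f01 {1F} {0F} eq = ⊥-elim (f01 (sym eq))
injective₂ _   {1F} {1F} _  = refl

injective₃ : ∀ {A : Set} {f : Fin 3 → A} → f 0F ≢ f 1F → f 0F ≢ f 2F → f 1F ≢ f 2F → Injective _≡_ _≡_ f
injective₃ _   _   _   {0F} {0F} _  = refl
injective₃ f01 _   _   {0F} {1F} eq = ⊥-elim (f01 eq)
injective₃ _   f02 _   {0F} {2F} eq = ⊥-elim (f02 eq)
injective₃ f01 _   _   {1F} {0F} eq = ⊥-elim (f01 (sym eq))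
injective₃ _   _   _   {1F} {1F} _  = refl
injective₃ _   _   f12 {1F} {2F} eq = ⊥-elim (f12 eq)
injective₃ _   f02 _   {2F} {0F} eq = ⊥-elim (f02 (sym eq))
injective₃ _   _   f12 {2F} {1F} eq = ⊥-elim (f12 (sym eq))
injective₃ _   _   _   {2F} {2F} _  = refl

does-true⇒ : ∀ {P : Set} (p? : Dec P) → does p? ≡ true → P
does-true⇒ (yes p) _ = p

↑ˡ≢↑ʳ : ∀ {k₁ k₂} (i : Fin k₁) (j : Fin k₂) → i ↑ˡ k₂ ≢ k₁ ↑ʳ j
↑ˡ≢↑ʳ {k₁} {k₂} i j eq
  with () ← trans (sym (splitAt-↑ˡ k₁ i k₂)) (trans (cong (splitAt k₁) eq) (splitAt-↑ʳ k₁ k₂ j))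

-- Separating 2-factors of C_m □_τ C_n from cycle partitions

module TwoFactors (m n : ℕ) .{{_ : NonZero n}} (τ : Fin n → Fin n) where

  private
    V : Set
    V = Vtx m n

    _≟ᵛ_ : DecidableEquality V
    _≟ᵛ_ = ≡-dec _≟ᶠ_ _≟ᶠ_

  adj-sym : ∀ {x y : V} → Adj m n τ x y → Adj m n τ y x
  adj-sym (inj₁ e) = inj₂ e
  adj-sym (inj₂ e) = inj₁ e

  Separable : ∀ {k} → (Fin k → V) → Set
  Separable a = ∃[ F ] (Is2Factor m n τ F × Separates F a)

  record Cycle : Set where
    field
      start end : V
      vertices  : List V
      path      : Path (Adj m n τ) start vertices end
      closing   : Adj m n τ end start
      long      : 3 ≤ length vertices

  allVertices : ∀ {k} → (Fin k → Cycle) → List V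
  allVertices cycle = concat (tabulate (Cycle.vertices ∘ cycle))

  record CyclePartition (k : ℕ) : Set where
    field
      cycle  : Fin k → Cycle
      part   : V → Fin k
      covers : ∀ v → v ∈ Cycle.vertices (cycle (part v))
      -- together with covers, this forces the cycles to be vertex-disjoint
      small  : length (allVertices cycle) ≤ m * n

  module PartitionFactor {k} (P : CyclePartition k) where
    open CyclePartition P

    private
      cycleOf : Fin k → List V
      cycleOf = Cycle.vertices ∘ cycle

      Neighbour : V → V → Set
      Neighbour x = CycleNeighbour (cycleOf (part x)) x

      neighbour? : ∀ x y → Dec (Neighbour x y)
      neighbour? x y = infix? _≟ᵛ_ _ _ ⊎-dec infix? _≟ᵛ_ _ _

    factor : V → V → Bool
    factor x y = does (neighbour? x y)

    private
      all-unique : Unique (allVertices cycle)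
      all-unique = covering-unique _≟ᵛ_ (Injection.injective (↔⇒↣ (*↔× {m} {n}))) (allVertices cycle)
                     (λ v → ∈-concat-tabulate cycleOf (part v) (covers v)) small

    part-sound : ∀ {c v} → v ∈ cycleOf c → part v ≡ c
    part-sound {c} {v} = unique-concat-tabulate⇒disjoint cycleOf all-unique (part v) c (covers v)

    neighbour-part : ∀ {x y} → Neighbour x y → part y ≡ part x
    neighbour-part = part-sound ∘ cycle-neighbour-∈

    factor⇒neighbour : ∀ {x y} → factor x y ≡ true → Neighbour x y
    factor⇒neighbour = does-true⇒ (neighbour? _ _)

    neighbour⇒factor : ∀ {x y} → Neighbour x y → factor x y ≡ true
    neighbour⇒factor = dec-true (neighbour? _ _)

    consecutive-adj : ∀ c {x y} → Consecutive x y (closed (cycleOf c)) → Adj m n τ x y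
    consecutive-adj c = cycle-consecutive (Cycle.path (cycle c)) (Cycle.closing (cycle c))

    factor-sym : ∀ x y → factor x y ≡ true → factor y x ≡ true
    factor-sym x y xy = neighbour⇒factor (subst (λ c → CycleNeighbour (cycleOf c) y x)
                          (sym (neighbour-part (factor⇒neighbour xy))) (swap (factor⇒neighbour xy)))

    factor-adj : ∀ x y → factor x y ≡ true → Adj m n τ x y
    factor-adj x y xy with factor⇒neighbour xy
    ... | inj₁ c = consecutive-adj (part x) c
    ... | inj₂ c = adj-sym (consecutive-adj (part x) c)

    factor-degree : ∀ x → ExactlyTwo (λ w → factor x w ≡ true)
    factor-degree x = ExactlyTwo-map neighbour⇒factor factor⇒neighbour
      (cycle-neighbours (unique-concat-tabulate⁻ cycleOf all-unique (part x))
                        (Cycle.long (cycle (part x))) (covers x))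

    factor-is-2-factor : Is2Factor m n τ factor
    factor-is-2-factor = record { symm = factor-sym ; subgraph = factor-adj ; degree2 = factor-degree }

    conn-part : ∀ {x y} → Conn factor x y → part x ≡ part y
    conn-part ε          = refl
    conn-part (xy ◅ yz) = trans (sym (neighbour-part (factor⇒neighbour xy))) (conn-part yz)

    conn-start : ∀ v → Conn factor (Cycle.start (cycle (part v))) v
    conn-start v = gmap id step (path-reachable (Cycle.path (cycle (part v))) (covers v))
      where
      step : ∀ {a b} → Consecutive a b (closed (cycleOf (part v))) → factor a b ≡ true
      step {a} ab = neighbour⇒factor (subst (λ c → CycleNeighbour (cycleOf c) a _)
                      (sym (part-sound (∈-closed⁻ (cycleOf (part v)) (consecutive-∈ˡ ab)))) (inj₁ ab))

  partition⇒separable : ∀ {k} (P : CyclePartition k) {a : Fin k → V} →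
                        Injective _≡_ _≡_ (CyclePartition.part P ∘ a) → Separable a
  partition⇒separable P {a} distinct = factor , factor-is-2-factor , covered , separated
    where
    open CyclePartition P
    open PartitionFactor P
    covered : ∀ v → ∃[ i ] Conn factor (a i) v
    covered v with i , hit ← injective⇒surjective distinct (part v) =
      i , Star.reverse (factor-sym _ _) (conn-start (a i))
          ◅◅ subst (λ c → Conn factor (Cycle.start (cycle c)) v) (sym (hit refl)) (conn-start v)
    separated : ∀ i i′ → Conn factor (a i) (a i′) → i ≡ i′
    separated i i′ = distinct ∘ conn-part

  transport : (φ : V ↔ V) → (∀ {x y} → Adj m n τ x y → Adj m n τ (Inverse.from φ x) (Inverse.from φ y)) →
              ∀ {k} {a : Fin k → V} → Separable (Inverse.to φ ∘ a) → Separable a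
  transport φ from-adj {a = a} (F , F-factor , covered , separated) =
    F′ , F′-factor , covered′ , λ i i′ → separated i i′ ∘ gmap to id
    where
    open Inverse φ
    open Is2Factor F-factor
    F′ : V → V → Bool
    F′ x y = F (to x) (to y)
    F′-factor : Is2Factor m n τ F′
    F′-factor = record
      { symm     = λ x y → symm (to x) (to y)
      ; subgraph = λ x y xy →
          subst₂ (Adj m n τ) (strictlyInverseʳ x) (strictlyInverseʳ y) (from-adj (subgraph _ _ xy))
      ; degree2  = λ x → ExactlyTwo-↔ φ (degree2 (to x))
      }
    F-edge : ∀ {u u′} → F u u′ ≡ true → F′ (from u) (from u′) ≡ true
    F-edge = subst₂ (λ u u′ → F u u′ ≡ true) (sym (strictlyInverseˡ _)) (sym (strictlyInverseˡ _))
    covered′ : ∀ v → ∃[ i ] Conn F′ (a i) v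
    covered′ v with i , c ← covered (to v) =
      i , subst₂ (Conn F′) (strictlyInverseʳ (a i)) (strictlyInverseʳ v) (gmap from F-edge c)

  reindex : ∀ {k} (π : Permutation′ k) {a : Fin k → V} → Separable (a ∘ (π ⟨$⟩ʳ_)) → Separable a
  reindex π {a} (F , F-factor , covered , separated) = F , F-factor , covered′ , separated′
    where
    covered′ : ∀ v → ∃[ i ] Conn F (a i) v
    covered′ v with i , c ← covered v = π ⟨$⟩ʳ i , c
    separated′ : ∀ i i′ → Conn F (a i) (a i′) → i ≡ i′
    separated′ i i′ c = begin
      i                   ≡⟨ inverseʳ π ⟨
      π ⟨$⟩ʳ (π ⟨$⟩ˡ i)   ≡⟨ cong (π ⟨$⟩ʳ_) (separated _ _ (subst₂ (Conn F) (a-inverse i) (a-inverse i′) c)) ⟩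
      π ⟨$⟩ʳ (π ⟨$⟩ˡ i′)  ≡⟨ inverseʳ π ⟩
      i′                  ∎
      where
      open ≡-Reasoning
      a-inverse : ∀ j → a j ≡ a (π ⟨$⟩ʳ (π ⟨$⟩ˡ j))
      a-inverse j = cong a (sym (inverseʳ π))

  row : V → ℕ
  row = toℕ ∘ proj₁

  record RowBlockPartition (p q k : ℕ) : Set where
    field
      cycle  : Fin k → Cycle
      part   : V → Fin k
      covers : ∀ v → p ≤ row v → row v ≤ q → v ∈ Cycle.vertices (cycle (part v))
      -- the block has n * (q + 1 - p) vertices, stated without subtraction so that blocks add up
      size   : length (allVertices cycle) + n * p ≡ n * suc q

  rowBlock⇒partition : ∀ {q k} → RowBlockPartition 0 q k → suc q ≡ m → CyclePartition k
  rowBlock⇒partition {q} B rows = record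
    { cycle  = cycle
    ; part   = part
    ; covers = λ v → covers v z≤n (≤-pred (subst (row v <_) (sym rows) (toℕ<n (proj₁ v))))
    ; small  = ≤-reflexive (begin
        length (allVertices cycle)          ≡⟨ +-identityʳ _ ⟨
        length (allVertices cycle) + 0      ≡⟨ cong (length (allVertices cycle) +_) (*-zeroʳ n) ⟨
        length (allVertices cycle) + n * 0  ≡⟨ size ⟩
        n * suc q                           ≡⟨ cong (n *_) rows ⟩
        n * m                               ≡⟨ *-comm n m ⟩
        m * n                               ∎)
    }
    where
    open RowBlockPartition B
    open ≡-Reasoning

  module _ {p q q′ k₁ k₂} (B₁ : RowBlockPartition p q k₁) (B₂ : RowBlockPartition (suc q) q′ k₂) where
    private
      module B₁ = RowBlockPartition B₁
      module B₂ = RowBlockPartition B₂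

      cycles : Fin k₁ ⊎ Fin k₂ → Cycle
      cycles = [ B₁.cycle , B₂.cycle ]′

      glued-part : V → Fin (k₁ + k₂)
      glued-part v = if does (row v ≤? q) then B₁.part v ↑ˡ k₂ else k₁ ↑ʳ B₂.part v

      glue-part-lower : ∀ {v} → row v ≤ q → glued-part v ≡ B₁.part v ↑ˡ k₂
      glue-part-lower {v} below rewrite dec-true (row v ≤? q) below = refl

      glue-part-upper : ∀ {v} → q < row v → glued-part v ≡ k₁ ↑ʳ B₂.part v
      glue-part-upper {v} above rewrite dec-false (row v ≤? q) (<⇒≱ above) = refl

    glue : RowBlockPartition p q′ (k₁ + k₂)
    glue = record { cycle = cycles ∘ splitAt k₁ ; part = glued-part ; covers = covers ; size = size }
      where
      covers : ∀ v → p ≤ row v → row v ≤ q′ → v ∈ Cycle.vertices (cycles (splitAt k₁ (glued-part v)))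
      covers v p≤ ≤q′ with row v ≤? q
      ... | yes below = subst (λ s → v ∈ Cycle.vertices (cycles s))
                          (sym (trans (cong (splitAt k₁) (glue-part-lower below)) (splitAt-↑ˡ k₁ _ k₂)))
                          (B₁.covers v p≤ below)
      ... | no  above = subst (λ s → v ∈ Cycle.vertices (cycles s))
                          (sym (trans (cong (splitAt k₁) (glue-part-upper (≰⇒> above))) (splitAt-↑ʳ k₁ k₂ _)))
                          (B₂.covers v (≰⇒> above) ≤q′)

      size : length (allVertices (cycles ∘ splitAt k₁)) + n * p ≡ n * suc q′
      size = begin
        length (allVertices (cycles ∘ splitAt k₁)) + n * p
          ≡⟨ cong (λ vs → length vs + n * p) (concat-tabulate-splitAt k₁ (Cycle.vertices ∘ cycles)) ⟩
        length (allVertices B₁.cycle ++ allVertices B₂.cycle) + n * p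
          ≡⟨ cong (_+ n * p) (length-++ (allVertices B₁.cycle)) ⟩
        ℓ₁ + ℓ₂ + n * p
          ≡⟨ rearrange ℓ₁ ℓ₂ (n * p) ⟩
        ℓ₂ + (ℓ₁ + n * p)
          ≡⟨ cong (ℓ₂ +_) B₁.size ⟩
        ℓ₂ + n * suc q
          ≡⟨ B₂.size ⟩
        n * suc q′ ∎
        where
        open ≡-Reasoning
        ℓ₁ = length (allVertices B₁.cycle)
        ℓ₂ = length (allVertices B₂.cycle)
        rearrange : ∀ a b c → a + b + c ≡ b + (a + c)
        rearrange = solve-∀

    glue-separates : ∀ x y → row x ≤ q → q < row y → glued-part x ≢ glued-part y
    glue-separates _ _ x≤q q<y eq = ↑ˡ≢↑ʳ _ _ (trans (sym (glue-part-lower x≤q)) (trans eq (glue-part-upper q<y)))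

    glue-separates-lower : ∀ x y → row x ≤ q → row y ≤ q → B₁.part x ≢ B₁.part y → glued-part x ≢ glued-part y
    glue-separates-lower _ _ x≤q y≤q split eq =
      split (↑ˡ-injective k₂ _ _ (trans (sym (glue-part-lower x≤q)) (trans eq (glue-part-lower y≤q))))

    glue-separates-upper : ∀ x y → q < row x → q < row y → B₂.part x ≢ B₂.part y → glued-part x ≢ glued-part y
    glue-separates-upper _ _ q<x q<y split eq =
      split (↑ʳ-injective k₁ _ _ (trans (sym (glue-part-upper q<x)) (trans eq (glue-part-upper q<y))))

-- The column cycle C₄ and τ₀

ColumnStep : Fin 4 → Fin 4 → Set
ColumnStep j j′ = toℕ j′ ≡ suc (toℕ j) % 4

columnStep? : ∀ j j′ → Dec (ColumnStep j j′)
columnStep? j j′ = toℕ j′ ℕ.≟ suc (toℕ j) % 4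

τ₀-involutive : ∀ j → τ₀ (τ₀ j) ≡ j
τ₀-involutive = from-yes (all? λ j → τ₀ (τ₀ j) ≟ᶠ j)

τ₀-reverses : ∀ j j′ → ColumnStep j j′ → ColumnStep (τ₀ j′) (τ₀ j)
τ₀-reverses = from-yes (all? λ j → all? λ j′ → columnStep? j j′ →-dec columnStep? (τ₀ j′) (τ₀ j))

-- κ c is the symmetry of the column cycle that commutes with τ₀ and sends column c to column 3.
κ : Fin 4 → Fin 4 → Fin 4
κ 0F = τ₀
κ 1F = λ { 0F → 2F ; 1F → 3F ; 2F → 0F ; 3F → 1F }
κ 2F = λ { 0F → 1F ; 1F → 0F ; 2F → 3F ; 3F → 2F }
κ 3F = id

κ-involutive : ∀ c j → κ c (κ c j) ≡ j
κ-involutive = from-yes (all? λ c → all? λ j → κ c (κ c j) ≟ᶠ j)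

κ-τ₀ : ∀ c j → κ c (τ₀ j) ≡ τ₀ (κ c j)
κ-τ₀ = from-yes (all? λ c → all? λ j → κ c (τ₀ j) ≟ᶠ τ₀ (κ c j))

κ-step : ∀ c j j′ → ColumnStep j j′ → ColumnStep (κ c j) (κ c j′) ⊎ ColumnStep (κ c j′) (κ c j)
κ-step = from-yes (all? λ c → all? λ j → all? λ j′ → columnStep? j j′ →-dec
  (columnStep? (κ c j) (κ c j′) ⊎-dec columnStep? (κ c j′) (κ c j)))

lastRowClass : Fin 4 → Fin 3
lastRowClass 0F = 0F
lastRowClass 1F = 1F
lastRowClass 2F = 2F
lastRowClass 3F = 2F

lastRowClass-κ : ∀ c x y → x ≢ c → y ≢ c → x ≢ y → lastRowClass (κ c x) ≢ lastRowClass (κ c y)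
lastRowClass-κ = from-yes (all? λ c → all? λ x → all? λ y →
  ¬? (x ≟ᶠ c) →-dec (¬? (y ≟ᶠ c) →-dec (¬? (x ≟ᶠ y) →-dec ¬? (lastRowClass (κ c x) ≟ᶠ lastRowClass (κ c y)))))

missing-column : ∀ (x y z : Fin 4) → x ≢ y → x ≢ z → y ≢ z → ∃ λ c → x ≢ c × y ≢ c × z ≢ c
missing-column = from-yes (all? λ (x : Fin 4) → all? λ (y : Fin 4) → all? λ (z : Fin 4) →
  ¬? (x ≟ᶠ y) →-dec (¬? (x ≟ᶠ z) →-dec (¬? (y ≟ᶠ z) →-dec
  any? λ (c : Fin 4) → ¬? (x ≟ᶠ c) ×-dec ¬? (y ≟ᶠ c) ×-dec ¬? (z ≟ᶠ c))))

record ColumnPairing : Set where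
  field
    side  : Fin 4 → Fin 2
    left  : Fin 2 → Fin 4
    right : Fin 2 → Fin 4
    step  : ∀ s → ColumnStep (left s) (right s)
    spans : ∀ j → j ≡ left (side j) ⊎ j ≡ right (side j)

pairing₀₁ : ColumnPairing
pairing₀₁ = record
  { side  = λ { 0F → 0F ; 1F → 0F ; 2F → 1F ; 3F → 1F }
  ; left  = λ { 0F → 0F ; 1F → 2F }
  ; right = λ { 0F → 1F ; 1F → 3F }
  ; step  = λ { 0F → refl ; 1F → refl }
  ; spans = λ { 0F → inj₁ refl ; 1F → inj₂ refl ; 2F → inj₁ refl ; 3F → inj₂ refl }
  }

pairing₃₀ : ColumnPairing
pairing₃₀ = record
  { side  = λ { 0F → 0F ; 1F → 1F ; 2F → 1F ; 3F → 0F }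
  ; left  = λ { 0F → 3F ; 1F → 1F }
  ; right = λ { 0F → 0F ; 1F → 2F }
  ; step  = λ { 0F → refl ; 1F → refl }
  ; spans = λ { 0F → inj₂ refl ; 1F → inj₁ refl ; 2F → inj₂ refl ; 3F → inj₁ refl }
  }

separating-pairing : ∀ {x y} → x ≢ y → ∃ λ P → ColumnPairing.side P x ≢ ColumnPairing.side P y
separating-pairing {x} {y} x≢y with ColumnPairing.side pairing₀₁ x ≟ᶠ ColumnPairing.side pairing₀₁ y
... | no  split = pairing₀₁ , split
... | yes same  = pairing₃₀ , other-pairing-splits x y x≢y same
  where
  other-pairing-splits : ∀ x y → x ≢ y → ColumnPairing.side pairing₀₁ x ≡ ColumnPairing.side pairing₀₁ y →
                         ColumnPairing.side pairing₃₀ x ≢ ColumnPairing.side pairing₃₀ y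
  other-pairing-splits = from-yes (all? λ x → all? λ y → ¬? (x ≟ᶠ y) →-dec
    ((ColumnPairing.side pairing₀₁ x ≟ᶠ ColumnPairing.side pairing₀₁ y) →-dec
     ¬? (ColumnPairing.side pairing₃₀ x ≟ᶠ ColumnPairing.side pairing₃₀ y)))

-- C_m □_τ₀ C₄

module TwistedTorus (n : ℕ) where

  m L : ℕ
  m = 3 + n
  L = 2 + n

  open TwoFactors m 4 τ₀ public

  V : Set
  V = Vtx m 4

  -- The row index is reduced modulo m; every use below passes a row below m.
  at : ℕ → Fin 4 → V
  at r j = r mod m , j

  toℕ-mod : ∀ {r} → r < m → toℕ (r mod m) ≡ r
  toℕ-mod r<m = trans (toℕ-fromℕ< _) (m<n⇒m%n≡m r<m)

  at-row : ∀ v → at (row v) (proj₂ v) ≡ v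
  at-row (i , j) = cong (_, j) (toℕ-injective (toℕ-mod (toℕ<n i)))

  horizontal : ∀ {i j j′} → ColumnStep j j′ → Adj m 4 τ₀ (i , j) (i , j′)
  horizontal step = inj₁ (horiz _ _ _ step)

  vertical : ∀ {r j} → suc r < m → Adj m 4 τ₀ (at r j) (at (suc r) j)
  vertical {r} r+1<m =
    inj₁ (vert _ _ _ (trans (toℕ-mod r+1<m) (cong suc (sym (toℕ-mod (<-trans (n<1+n r) r+1<m))))))

  twisted : ∀ {j} → Adj m 4 τ₀ (at L j) (at 0 (τ₀ j))
  twisted = inj₁ (twist _ _ _ (cong suc (toℕ-mod ≤-refl)) refl)

  private
    descent : Fin 4 → ℕ → ℕ → List V
    descent j p zero    = [ at p j ]
    descent j p (suc d) = at p j ∷ descent j (suc p) d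

    descent-path : ∀ j p d → p + d < m → Path (Adj m 4 τ₀) (at p j) (descent j p d) (at (p + d) j)
    descent-path j p zero    p+d<m rewrite +-identityʳ p = [ _ ]ᵖ
    descent-path j p (suc d) p+d<m rewrite +-suc p d =
      vertical (≤-trans (s≤s (s≤s (m≤m+n p d))) p+d<m) ∷ descent-path j (suc p) d p+d<m

    ∈-descent : ∀ j p d {r} → p ≤ r → r ≤ p + d → at r j ∈ descent j p d
    ∈-descent j p zero    p≤r r≤p+0 =
      here (cong (λ r → at r j) (≤-antisym (subst (_ ≤_) (+-identityʳ p) r≤p+0) p≤r))
    ∈-descent j p (suc d) {r} p≤r r≤ with p ℕ.≟ r
    ... | yes refl = here refl
    ... | no  p≢r  = there (∈-descent j (suc p) d (≤∧≢⇒< p≤r p≢r) (subst (r ≤_) (+-suc p d) r≤))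

    length-descent : ∀ j p d → length (descent j p d) ≡ suc d
    length-descent j p zero    = refl
    length-descent j p (suc d) = cong suc (length-descent j (suc p) d)

  run : Fin 4 → ℕ → ℕ → List V
  run j p q = descent j p (q ∸ p)

  run-path : ∀ j {p q} → p ≤ q → q < m → Path (Adj m 4 τ₀) (at p j) (run j p q) (at q j)
  run-path j {p} {q} p≤q q<m = subst (λ r → Path (Adj m 4 τ₀) (at p j) (run j p q) (at r j)) (m+[n∸m]≡n p≤q)
    (descent-path j p (q ∸ p) (subst (_< m) (sym (m+[n∸m]≡n p≤q)) q<m))

  ∈-run : ∀ {p q v} → p ≤ row v → row v ≤ q → v ∈ run (proj₂ v) p q
  ∈-run {p} {q} {v} p≤ ≤q = subst (_∈ run (proj₂ v) p q) (at-row v)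
    (∈-descent (proj₂ v) p (q ∸ p) p≤ (≤-trans ≤q (m≤n+m∸n q p)))

  length-run : ∀ j p q → length (run j p q) ≡ suc (q ∸ p)
  length-run j p q = length-descent j p (q ∸ p)

  run-stack : ∀ {p q} → p ≤ q → 4 * suc (q ∸ p) + 4 * p ≡ 4 * suc q
  run-stack {p} {q} p≤q = trans (sym (*-distribˡ-+ 4 (suc (q ∸ p)) p)) (cong (λ r → 4 * suc r) (m∸n+n≡m p≤q))

  bandVertices : ℕ → ℕ → List V
  bandVertices p q = run 0F p q ++ reverse (run 3F p q) ++ run 2F p q ++ reverse (run 1F p q)

  length-bandVertices : ∀ p q → length (bandVertices p q) ≡ 4 * suc (q ∸ p)
  length-bandVertices p q
    rewrite length-++ (run 0F p q) {reverse (run 3F p q) ++ run 2F p q ++ reverse (run 1F p q)}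
          | length-++ (reverse (run 3F p q)) {run 2F p q ++ reverse (run 1F p q)}
          | length-++ (run 2F p q) {reverse (run 1F p q)}
          | length-reverse (run 3F p q) | length-reverse (run 1F p q)
          | length-run 0F p q | length-run 3F p q | length-run 2F p q | length-run 1F p q
          | +-identityʳ (suc (q ∸ p)) = refl

  ∈-bandVertices : ∀ {p q v} → p ≤ row v → row v ≤ q → v ∈ bandVertices p q
  ∈-bandVertices {p} {q} {_ , 0F} p≤ ≤q = ∈-++⁺ˡ (∈-run p≤ ≤q)
  ∈-bandVertices {p} {q} {_ , 3F} p≤ ≤q = ∈-++⁺ʳ (run 0F p q) (∈-++⁺ˡ (reverse⁺ (∈-run p≤ ≤q)))
  ∈-bandVertices {p} {q} {_ , 2F} p≤ ≤q =
    ∈-++⁺ʳ (run 0F p q) (∈-++⁺ʳ (reverse (run 3F p q)) (∈-++⁺ˡ (∈-run p≤ ≤q)))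
  ∈-bandVertices {p} {q} {_ , 1F} p≤ ≤q =
    ∈-++⁺ʳ (run 0F p q) (∈-++⁺ʳ (reverse (run 3F p q)) (∈-++⁺ʳ (run 2F p q) (reverse⁺ (∈-run p≤ ≤q))))

  band : ∀ {p q} → p ≤ q → q < m → Cycle
  band {p} {q} p≤q q<m = record
    { start    = at p 0F
    ; end      = at p 1F
    ; vertices = bandVertices p q
    ; path     = path-++ (run-path 0F p≤q q<m) (adj-sym (horizontal refl))
                (path-++ (path-reverse adj-sym (run-path 3F p≤q q<m)) (adj-sym (horizontal refl))
                (path-++ (run-path 2F p≤q q<m) (adj-sym (horizontal refl))
                         (path-reverse adj-sym (run-path 1F p≤q q<m))))
    ; closing  = adj-sym (horizontal refl)
    ; long     = subst (3 ≤_) (sym (length-bandVertices p q)) (≤-trans (n≤1+n 3) (m≤m*n 4 (suc (q ∸ p))))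
    }

  bandBlock : ∀ {p q} → p ≤ q → q < m → RowBlockPartition p q 1
  bandBlock {p} {q} p≤q q<m = record
    { cycle  = λ _ → band p≤q q<m
    ; part   = λ _ → 0F
    ; covers = λ _ → ∈-bandVertices
    ; size   = trans (cong (λ vs → length vs + 4 * p) (++-identityʳ (bandVertices p q)))
                     (trans (cong (_+ 4 * p) (length-bandVertices p q)) (run-stack p≤q))
    }

  rectangleVertices : Fin 4 → Fin 4 → ℕ → ℕ → List V
  rectangleVertices c c′ p q = run c p q ++ reverse (run c′ p q)

  length-rectangleVertices : ∀ c c′ p q → length (rectangleVertices c c′ p q) ≡ suc (q ∸ p) + suc (q ∸ p)
  length-rectangleVertices c c′ p q
    rewrite length-++ (run c p q) {reverse (run c′ p q)} | length-reverse (run c′ p q)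
          | length-run c p q | length-run c′ p q = refl

  ∈-rectangleVertices : ∀ {c c′ p q v} → proj₂ v ≡ c ⊎ proj₂ v ≡ c′ → p ≤ row v → row v ≤ q →
                        v ∈ rectangleVertices c c′ p q
  ∈-rectangleVertices {c} {c′} {p} {q} {v} (inj₁ refl) p≤ ≤q = ∈-++⁺ˡ (∈-run p≤ ≤q)
  ∈-rectangleVertices {c} {c′} {p} {q} {v} (inj₂ refl) p≤ ≤q = ∈-++⁺ʳ (run c p q) (reverse⁺ (∈-run p≤ ≤q))

  rectangle : ∀ c c′ {p q} → ColumnStep c c′ → p < q → q < m → Cycle
  rectangle c c′ {p} {q} step p<q q<m = record
    { start    = at p c
    ; end      = at p c′
    ; vertices = rectangleVertices c c′ p q
    ; path     = path-++ (run-path c (<⇒≤ p<q) q<m) (horizontal step)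
                         (path-reverse adj-sym (run-path c′ (<⇒≤ p<q) q<m))
    ; closing  = adj-sym (horizontal step)
    ; long     = subst (3 ≤_) (sym (length-rectangleVertices c c′ p q)) (+-mono-≤ two≤ (≤-trans (s≤s z≤n) two≤))
    }
    where
    two≤ : 2 ≤ suc (q ∸ p)
    two≤ = s≤s (m<n⇒0<n∸m p<q)

  pairingBlock : ColumnPairing → ∀ {p q} → p < q → q < m → RowBlockPartition p q 2
  pairingBlock P {p} {q} p<q q<m = record
    { cycle  = λ s → rectangle (left s) (right s) (step s) p<q q<m
    ; part   = side ∘ proj₂
    ; covers = λ v → ∈-rectangleVertices (spans (proj₂ v))
    ; size   = size
    }
    where
    open ColumnPairing P
    ℓ = suc (q ∸ p)
    size : length (rectangleVertices (left 0F) (right 0F) p q ++ rectangleVertices (left 1F) (right 1F) p q ++ [])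
             + 4 * p ≡ 4 * suc q
    size rewrite ++-identityʳ (rectangleVertices (left 1F) (right 1F) p q)
               | length-++ (rectangleVertices (left 0F) (right 0F) p q) {rectangleVertices (left 1F) (right 1F) p q}
               | length-rectangleVertices (left 0F) (right 0F) p q
               | length-rectangleVertices (left 1F) (right 1F) p q
               = trans (cong (_+ 4 * p) (two-doubles ℓ)) (run-stack (<⇒≤ p<q))
      where
      two-doubles : ∀ ℓ → ℓ + ℓ + (ℓ + ℓ) ≡ 4 * ℓ
      two-doubles = solve-∀

  vertex-at : ∀ {v r} → row v ≡ r → v ≡ at r (proj₂ v)
  vertex-at {v} refl = sym (at-row v)

  -- Three vertices in the last row L, none in column 3, are separated by: for c = 0, 1 the hook
  -- (L-1,c) (L,c), twisted edge, down column τ₀ c to row L-1; and the loop (L,3), twisted edge,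
  -- down column 0 to row L-2, up column 1, twisted edge to (L,2).
  hookVertices : Fin 4 → List V
  hookVertices c = at (suc n) c ∷ at L c ∷ run (τ₀ c) 0 (suc n)

  length-hookVertices : ∀ c → length (hookVertices c) ≡ 4 + n
  length-hookVertices c = cong (2 +_) (length-run (τ₀ c) 0 (suc n))

  hook : ∀ c → Adj m 4 τ₀ (at (suc n) (τ₀ c)) (at (suc n) c) → Cycle
  hook c closing = record
    { start    = at (suc n) c
    ; end      = at (suc n) (τ₀ c)
    ; vertices = hookVertices c
    ; path     = vertical ≤-refl ∷ twisted ∷ run-path (τ₀ c) z≤n (n≤1+n L)
    ; closing  = closing
    ; long     = subst (3 ≤_) (sym (length-hookVertices c)) (s≤s (s≤s (s≤s z≤n)))
    }

  loopVertices : List V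
  loopVertices = at L 3F ∷ run 0F 0 n ++ reverse (run 1F 0 n) ++ [ at L 2F ]

  length-loopVertices : length loopVertices ≡ suc (suc n + (suc n + 1))
  length-loopVertices
    rewrite length-++ (run 0F 0 n) {reverse (run 1F 0 n) ++ [ at L 2F ]}
          | length-++ (reverse (run 1F 0 n)) {[ at L 2F ]}
          | length-reverse (run 1F 0 n) | length-run 0F 0 n | length-run 1F 0 n = refl

  loop : Cycle
  loop = record
    { start    = at L 3F
    ; end      = at L 2F
    ; vertices = loopVertices
    ; path     = twisted ∷ path-++ (run-path 0F z≤n n<m) (horizontal refl)
                            (path-++ (path-reverse adj-sym (run-path 1F z≤n n<m)) (adj-sym twisted) [ at L 2F ]ᵖ)
    ; closing  = horizontal refl
    ; long     = subst (3 ≤_) (sym length-loopVertices) (s≤s (s≤s (≤-trans (s≤s z≤n) (m≤n+m (suc n + 1) n))))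
    }
    where
    n<m : n < m
    n<m = ≤-trans (n≤1+n (suc n)) (n≤1+n L)

  last-row-high : ∀ {r} → r ≡ L → r ≰ suc n
  last-row-high last low = 1+n≰n (subst (_≤ suc n) last low)

  twistedPart : V → Fin 3
  twistedPart (i , 0F) with toℕ i ≤? n
  ... | yes _ = 2F
  ... | no  _ = 0F
  twistedPart (i , 1F) with toℕ i ≤? n
  ... | yes _ = 2F
  ... | no  _ = 1F
  twistedPart (i , 2F) with toℕ i ≤? suc n
  ... | yes _ = 1F
  ... | no  _ = 2F
  twistedPart (i , 3F) with toℕ i ≤? suc n
  ... | yes _ = 0F
  ... | no  _ = 2F

  twistedPart-lastRow : ∀ {v} → row v ≡ L → twistedPart v ≡ lastRowClass (proj₂ v)
  twistedPart-lastRow {i , 0F} last with toℕ i ≤? n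
  ... | yes low = ⊥-elim (last-row-high last (≤-trans low (n≤1+n n)))
  ... | no  _   = refl
  twistedPart-lastRow {i , 1F} last with toℕ i ≤? n
  ... | yes low = ⊥-elim (last-row-high last (≤-trans low (n≤1+n n)))
  ... | no  _   = refl
  twistedPart-lastRow {i , 2F} last with toℕ i ≤? suc n
  ... | yes low = ⊥-elim (last-row-high last low)
  ... | no  _   = refl
  twistedPart-lastRow {i , 3F} last with toℕ i ≤? suc n
  ... | yes low = ⊥-elim (last-row-high last low)
  ... | no  _   = refl

  private
    top-two-rows : ∀ v → n < row v → row v ≡ suc n ⊎ row v ≡ L
    top-two-rows v n< with row v ℕ.≟ suc n
    ... | yes eq = inj₁ eq
    ... | no  ne = inj₂ (≤-antisym (≤-pred (toℕ<n (proj₁ v))) (≤∧≢⇒< n< (ne ∘ sym)))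

    lastRow : ∀ v → suc n < row v → row v ≡ L
    lastRow v n< = ≤-antisym (≤-pred (toℕ<n (proj₁ v))) n<

  twistedCycle : Fin 3 → Cycle
  twistedCycle 0F = hook 0F (horizontal refl)
  twistedCycle 1F = hook 1F (adj-sym (horizontal refl))
  twistedCycle 2F = loop

  twisted-covers : ∀ v → v ∈ Cycle.vertices (twistedCycle (twistedPart v))
  twisted-covers (i , 0F) with toℕ i ≤? n
  ... | yes le = there (∈-++⁺ˡ (∈-run z≤n le))
  ... | no  gt with top-two-rows (i , 0F) (≰⇒> gt)
  ...   | inj₁ eq = here (vertex-at eq)
  ...   | inj₂ eq = there (here (vertex-at eq))
  twisted-covers (i , 1F) with toℕ i ≤? n
  ... | yes le = there (∈-++⁺ʳ (run 0F 0 n) (∈-++⁺ˡ (reverse⁺ (∈-run z≤n le))))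
  ... | no  gt with top-two-rows (i , 1F) (≰⇒> gt)
  ...   | inj₁ eq = here (vertex-at eq)
  ...   | inj₂ eq = there (here (vertex-at eq))
  twisted-covers (i , 2F) with toℕ i ≤? suc n
  ... | yes le = there (there (∈-run z≤n le))
  ... | no  gt =
    there (∈-++⁺ʳ (run 0F 0 n) (∈-++⁺ʳ (reverse (run 1F 0 n)) (here (vertex-at (lastRow (i , 2F) (≰⇒> gt))))))
  twisted-covers (i , 3F) with toℕ i ≤? suc n
  ... | yes le = there (there (∈-run z≤n le))
  ... | no  gt = here (vertex-at (lastRow (i , 3F) (≰⇒> gt)))

  twistedPartition : CyclePartition 3
  twistedPartition = record
    { cycle  = twistedCycle
    ; part   = twistedPart
    ; covers = twisted-covers
    ; small  = ≤-reflexive total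
    }
    where
    total : length (allVertices twistedCycle) ≡ m * 4
    total = begin
      length (hookVertices 0F ++ hookVertices 1F ++ loopVertices ++ [])
        ≡⟨ cong (λ vs → length (hookVertices 0F ++ hookVertices 1F ++ vs)) (++-identityʳ loopVertices) ⟩
      length (hookVertices 0F ++ hookVertices 1F ++ loopVertices)
        ≡⟨ length-++ (hookVertices 0F) ⟩
      length (hookVertices 0F) + length (hookVertices 1F ++ loopVertices)
        ≡⟨ cong (length (hookVertices 0F) +_) (length-++ (hookVertices 1F)) ⟩
      length (hookVertices 0F) + (length (hookVertices 1F) + length loopVertices)
        ≡⟨ cong₂ (λ a b → a + (b + length loopVertices)) (length-hookVertices 0F) (length-hookVertices 1F) ⟩
      4 + n + (4 + n + length loopVertices)
        ≡⟨ cong (λ ℓ → 4 + n + (4 + n + ℓ)) length-loopVertices ⟩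
      4 + n + (4 + n + suc (suc n + (suc n + 1)))
        ≡⟨ count n ⟩
      m * 4 ∎
      where
      open ≡-Reasoning
      count : ∀ n → 4 + n + (4 + n + suc (suc n + (suc n + 1))) ≡ (3 + n) * 4
      count = solve-∀

  -- down is the row shift (i , j) ↦ (i + 1 , j), applying τ₀ when it leaves the last row.
  rowDown : Fin m → Fin m
  rowDown i with view i
  ... | ‵fromℕ     = zero
  ... | ‵inject₁ k = suc k

  colDown : Fin m → Fin 4 → Fin 4
  colDown i j with view i
  ... | ‵fromℕ     = τ₀ j
  ... | ‵inject₁ _ = j

  rowUp : Fin m → Fin m
  rowUp zero    = fromℕ L
  rowUp (suc k) = inject₁ k

  colUp : Fin m → Fin 4 → Fin 4
  colUp zero    = τ₀
  colUp (suc _) = id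

  down up : V → V
  down (i , j) = rowDown i , colDown i j
  up   (i , j) = rowUp i , colUp i j

  up-down : ∀ v → up (down v) ≡ v
  up-down (i , j) with view i
  ... | ‵fromℕ     = cong (fromℕ L ,_) (τ₀-involutive j)
  ... | ‵inject₁ k = refl

  down-up : ∀ v → down (up v) ≡ v
  down-up (zero , j)  rewrite view-fromℕ L = cong (zero ,_) (τ₀-involutive j)
  down-up (suc k , j) rewrite view-inject₁ k = refl

  up-edge : ∀ {x y} → Edge m 4 τ₀ x y → Adj m 4 τ₀ (up x) (up y)
  up-edge (horiz zero    j j′ step) = adj-sym (horizontal (τ₀-reverses j j′ step))
  up-edge (horiz (suc _) j j′ step) = horizontal step
  up-edge (vert zero (suc zero) j refl) =
    inj₁ (subst (λ j′ → Edge m 4 τ₀ (fromℕ L , τ₀ j) (zero , j′)) (τ₀-involutive j)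
                (twist _ _ _ (cong suc (toℕ-fromℕ L)) refl))
  up-edge (vert (suc k) (suc k′) j eq) =
    inj₁ (vert _ _ j (trans (toℕ-inject₁ k′) (trans (suc-injective eq) (cong suc (sym (toℕ-inject₁ k))))))
  up-edge (twist (suc k) zero j last refl) =
    inj₁ (subst (λ j′ → Edge m 4 τ₀ (inject₁ k , j) (fromℕ L , j′)) (sym (τ₀-involutive j))
      (vert _ _ j (trans (toℕ-fromℕ L) (trans (sym (suc-injective last)) (cong suc (sym (toℕ-inject₁ k)))))))

  up-adj : ∀ {x y} → Adj m 4 τ₀ x y → Adj m 4 τ₀ (up x) (up y)
  up-adj (inj₁ e) = up-edge e
  up-adj (inj₂ e) = adj-sym (up-edge e)

  shift : V ↔ V
  shift = mk↔ₛ′ down up down-up up-down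

  shift^ : ℕ → V ↔ V
  shift^ zero    = ↔-refl
  shift^ (suc s) = ↔-trans shift (shift^ s)

  shift^-from-adj : ∀ s {x y} → Adj m 4 τ₀ x y →
                    Adj m 4 τ₀ (Inverse.from (shift^ s) x) (Inverse.from (shift^ s) y)
  shift^-from-adj zero    xy = xy
  shift^-from-adj (suc s) xy = up-adj (shift^-from-adj s xy)

  separable-shift^ : ∀ s {k} {a : Fin k → V} → Separable (Inverse.to (shift^ s) ∘ a) → Separable a
  separable-shift^ s = transport (shift^ s) (shift^-from-adj s)

  same-row-shift^ : ∀ s {x y} →
                    proj₁ x ≡ proj₁ y ⇔ proj₁ (Inverse.to (shift^ s) x) ≡ proj₁ (Inverse.to (shift^ s) y)
  same-row-shift^ zero    = mk⇔ id id
  same-row-shift^ (suc s) {x} {y} = ⇔-trans (mk⇔ (cong rowDown) λ eq →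
    trans (sym (cong proj₁ (up-down x))) (trans (cong rowUp eq) (cong proj₁ (up-down y)))) (same-row-shift^ s)

  row-down : ∀ v → row v < L → row (down v) ≡ suc (row v)
  row-down (i , _) below with view i
  ... | ‵fromℕ     = ⊥-elim (<-irrefl (toℕ-fromℕ L) below)
  ... | ‵inject₁ k = cong suc (sym (toℕ-inject₁ k))

  row-shift^ : ∀ s v → row v + s ≤ L → row (Inverse.to (shift^ s) v) ≡ row v + s
  row-shift^ zero    v _    = sym (+-identityʳ (row v))
  row-shift^ (suc s) v fits = begin
    row (Inverse.to (shift^ s) (down v)) ≡⟨ row-shift^ s (down v) (subst (_≤ L) one-down fits) ⟩
    row (down v) + s                     ≡⟨ one-down ⟨
    row v + suc s                        ∎
    where
    open ≡-Reasoning
    one-down : row v + suc s ≡ row (down v) + s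
    one-down = trans (+-suc (row v) s) (cong (_+ s) (sym (row-down v (<-≤-trans (m<m+n (row v) (s≤s z≤n)) fits))))

  shift-to-lastRow : ∀ v → row (Inverse.to (shift^ (L ∸ row v)) v) ≡ L
  shift-to-lastRow v = trans (row-shift^ (L ∸ row v) v (≤-reflexive eq)) eq
    where
    eq : row v + (L ∸ row v) ≡ L
    eq = m+[n∸m]≡n (≤-pred (toℕ<n (proj₁ v)))

  columnSymmetry : Fin 4 → V ↔ V
  columnSymmetry c = mk↔ₛ′ flip flip involutive involutive
    where
    flip : V → V
    flip (i , j) = i , κ c j
    involutive : ∀ v → flip (flip v) ≡ v
    involutive (i , j) = cong (i ,_) (κ-involutive c j)

  columnSymmetry-edge : ∀ c {x y} → Edge m 4 τ₀ x y →
                        Adj m 4 τ₀ (Inverse.from (columnSymmetry c) x) (Inverse.from (columnSymmetry c) y)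
  columnSymmetry-edge c (horiz i j j′ step) with κ-step c j j′ step
  ... | inj₁ step′ = horizontal step′
  ... | inj₂ step′ = adj-sym (horizontal step′)
  columnSymmetry-edge c (vert i i′ j eq) = inj₁ (vert i i′ (κ c j) eq)
  columnSymmetry-edge c (twist i i′ j last first) =
    inj₁ (subst (λ j′ → Edge m 4 τ₀ (i , κ c j) (i′ , j′)) (sym (κ-τ₀ c j)) (twist i i′ (κ c j) last first))

  separable-columnSymmetry : ∀ c {k} {a : Fin k → V} → Separable (Inverse.to (columnSymmetry c) ∘ a) → Separable a
  separable-columnSymmetry c = transport (columnSymmetry c) λ where
    (inj₁ e) → columnSymmetry-edge c e
    (inj₂ e) → adj-sym (columnSymmetry-edge c e)

  column-differs : ∀ {x y : V} → proj₁ x ≡ proj₁ y → x ≢ y → proj₂ x ≢ proj₂ y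
  column-differs {_ , _} {_ , _} refl x≢y refl = x≢y refl

  increasing-rows₂ : ∀ (a : Fin 2 → V) → row (a 0F) < row (a 1F) → Separable a
  increasing-rows₂ a r₀<r₁ = partition⇒separable (rowBlock⇒partition (glue B₀ B₁) refl)
    (injective₂ (glue-separates B₀ B₁ (a 0F) (a 1F) ≤-refl r₀<r₁))
    where
    B₀ : RowBlockPartition 0 (row (a 0F)) 1
    B₀ = bandBlock z≤n (toℕ<n (proj₁ (a 0F)))
    B₁ : RowBlockPartition (suc (row (a 0F))) L 1
    B₁ = bandBlock (≤-trans r₀<r₁ (≤-pred (toℕ<n (proj₁ (a 1F))))) ≤-refl

  increasing-rows₃ : ∀ (a : Fin 3 → V) → row (a 0F) < row (a 1F) → row (a 1F) < row (a 2F) → Separable a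
  increasing-rows₃ a r₀<r₁ r₁<r₂ = partition⇒separable (rowBlock⇒partition (glue B₀ (glue B₁ B₂)) refl)
    (injective₃ (glue-separates B₀ (glue B₁ B₂) (a 0F) (a 1F) ≤-refl r₀<r₁)
                (glue-separates B₀ (glue B₁ B₂) (a 0F) (a 2F) ≤-refl (<-trans r₀<r₁ r₁<r₂))
                (glue-separates-upper B₀ (glue B₁ B₂) (a 1F) (a 2F) r₀<r₁ (<-trans r₀<r₁ r₁<r₂)
                   (glue-separates B₁ B₂ (a 1F) (a 2F) ≤-refl r₁<r₂)))
    where
    B₀ : RowBlockPartition 0 (row (a 0F)) 1
    B₀ = bandBlock z≤n (toℕ<n (proj₁ (a 0F)))
    B₁ : RowBlockPartition (suc (row (a 0F))) (row (a 1F)) 1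
    B₁ = bandBlock r₀<r₁ (toℕ<n (proj₁ (a 1F)))
    B₂ : RowBlockPartition (suc (row (a 1F))) L 1
    B₂ = bandBlock (≤-trans r₁<r₂ (≤-pred (toℕ<n (proj₁ (a 2F))))) ≤-refl

  same-row₂ : ∀ (a : Fin 2 → V) → proj₁ (a 0F) ≡ proj₁ (a 1F) → a 0F ≢ a 1F → Separable a
  same-row₂ a same distinct with P , split ← separating-pairing (column-differs same distinct) =
    partition⇒separable (rowBlock⇒partition (pairingBlock P (s≤s z≤n) ≤-refl) refl) (injective₂ split)

  pair-below-lastRow : ∀ (a : Fin 3 → V) → proj₁ (a 0F) ≡ proj₁ (a 1F) → a 0F ≢ a 1F →
                       row (a 0F) ≢ L → row (a 2F) ≡ L → Separable a
  pair-below-lastRow a same distinct r₀≢L r₂≡L with P , split ← separating-pairing (column-differs same distinct) =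
    partition⇒separable (rowBlock⇒partition (glue B₀ B₁) refl)
      (injective₃ (glue-separates-lower B₀ B₁ (a 0F) (a 1F) r₀<L (subst (_≤ suc n) (cong toℕ same) r₀<L) split)
                  (glue-separates B₀ B₁ (a 0F) (a 2F) r₀<L top)
                  (glue-separates B₀ B₁ (a 1F) (a 2F) (subst (_≤ suc n) (cong toℕ same) r₀<L) top))
    where
    B₀ : RowBlockPartition 0 (suc n) 2
    B₀ = pairingBlock P (s≤s z≤n) (n≤1+n L)
    B₁ : RowBlockPartition L L 1
    B₁ = bandBlock ≤-refl ≤-refl
    r₀<L : row (a 0F) ≤ suc n
    r₀<L = ≤-pred (≤∧≢⇒< (≤-pred (toℕ<n (proj₁ (a 0F)))) r₀≢L)
    top : suc n < row (a 2F)
    top = ≤-reflexive (sym r₂≡L)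

  three-in-lastRow : ∀ (a : Fin 3 → V) → Injective _≡_ _≡_ a → (∀ i → row (a i) ≡ L) → Separable a
  three-in-lastRow a a-inj last =
    separate (missing-column _ _ _ (differ 0F 1F (λ ())) (differ 0F 2F (λ ())) (differ 1F 2F (λ ())))
    where
    column : Fin 3 → Fin 4
    column = proj₂ ∘ a
    differ : ∀ i j → i ≢ j → column i ≢ column j
    differ i j i≢j = column-differs (toℕ-injective (trans (last i) (sym (last j)))) (contraInjective a-inj i≢j)
    separate : ∃ (λ c → column 0F ≢ c × column 1F ≢ c × column 2F ≢ c) → Separable a
    separate (c , c₀≢c , c₁≢c , c₂≢c) = separable-columnSymmetry c (partition⇒separable twistedPartition
      (injective₃ (split 0F 1F (lastRowClass-κ c _ _ c₀≢c c₁≢c (differ 0F 1F (λ ()))))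
                  (split 0F 2F (lastRowClass-κ c _ _ c₀≢c c₂≢c (differ 0F 2F (λ ()))))
                  (split 1F 2F (lastRowClass-κ c _ _ c₁≢c c₂≢c (differ 1F 2F (λ ()))))))
      where
      split : ∀ i j → lastRowClass (κ c (column i)) ≢ lastRowClass (κ c (column j)) →
              twistedPart (proj₁ (a i) , κ c (column i)) ≢ twistedPart (proj₁ (a j) , κ c (column j))
      split i j classes-differ eq =
        classes-differ (trans (sym (twistedPart-lastRow (last i))) (trans eq (twistedPart-lastRow (last j))))

  same-row₃ : ∀ (a : Fin 3 → V) → Injective _≡_ _≡_ a → row (a 0F) ≡ row (a 1F) → row (a 0F) ≡ row (a 2F) → Separable a
  same-row₃ a a-inj r₀≡r₁ r₀≡r₂ =
    separable-shift^ s (three-in-lastRow b (a-inj ∘ Injection.injective (↔⇒↣ (shift^ s))) last)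
    where
    s = L ∸ row (a 0F)
    b : Fin 3 → V
    b = Inverse.to (shift^ s) ∘ a
    last : ∀ i → row (b i) ≡ L
    last 0F = shift-to-lastRow (a 0F)
    last 1F = trans (cong toℕ (sym (Equivalence.to (same-row-shift^ s) (toℕ-injective r₀≡r₁))))
                    (shift-to-lastRow (a 0F))
    last 2F = trans (cong toℕ (sym (Equivalence.to (same-row-shift^ s) (toℕ-injective r₀≡r₂))))
                    (shift-to-lastRow (a 0F))

  pair-and-lone : ∀ (a : Fin 3 → V) → a 0F ≢ a 1F → row (a 0F) ≡ row (a 1F) → row (a 0F) ≢ row (a 2F) → Separable a
  pair-and-lone a distinct r₀≡r₁ r₀≢r₂ = separable-shift^ s
    (pair-below-lastRow b (Equivalence.to (same-row-shift^ s) (toℕ-injective r₀≡r₁))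
      (distinct ∘ Injection.injective (↔⇒↣ (shift^ s))) b₀-below (shift-to-lastRow (a 2F)))
    where
    s = L ∸ row (a 2F)
    b : Fin 3 → V
    b = Inverse.to (shift^ s) ∘ a
    b₀-below : row (b 0F) ≢ L
    b₀-below r₀≡L = r₀≢r₂ (cong toℕ (Equivalence.from (same-row-shift^ s)
                       (toℕ-injective (trans r₀≡L (sym (shift-to-lastRow (a 2F)))))))

  distinct-rows₃ : ∀ (a : Fin 3 → V) → row (a 0F) ≢ row (a 1F) → row (a 0F) ≢ row (a 2F) → row (a 1F) ≢ row (a 2F) →
                   Separable a
  distinct-rows₃ a r₀≢r₁ r₀≢r₂ r₁≢r₂
    with <-cmp (row (a 0F)) (row (a 1F)) | <-cmp (row (a 1F)) (row (a 2F)) | <-cmp (row (a 0F)) (row (a 2F))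
  ... | tri≈ _ r₀≡r₁ _ | _ | _ = ⊥-elim (r₀≢r₁ r₀≡r₁)
  ... | _ | tri≈ _ r₁≡r₂ _ | _ = ⊥-elim (r₁≢r₂ r₁≡r₂)
  ... | _ | _ | tri≈ _ r₀≡r₂ _ = ⊥-elim (r₀≢r₂ r₀≡r₂)
  ... | tri< r₀<r₁ _ _ | tri< r₁<r₂ _ _ | _ = increasing-rows₃ a r₀<r₁ r₁<r₂
  ... | tri< r₀<r₁ _ _ | tri> _ _ r₂<r₁ | tri< r₀<r₂ _ _ = reindex (transpose 1F 2F) (increasing-rows₃ _ r₀<r₂ r₂<r₁)
  ... | tri< r₀<r₁ _ _ | tri> _ _ r₂<r₁ | tri> _ _ r₂<r₀ =
    reindex (transpose 0F 2F) (reindex (transpose 1F 2F) (increasing-rows₃ _ r₂<r₀ r₀<r₁))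
  ... | tri> _ _ r₁<r₀ | tri< r₁<r₂ _ _ | tri< r₀<r₂ _ _ = reindex (transpose 0F 1F) (increasing-rows₃ _ r₁<r₀ r₀<r₂)
  ... | tri> _ _ r₁<r₀ | tri< r₁<r₂ _ _ | tri> _ _ r₂<r₀ =
    reindex (transpose 0F 1F) (reindex (transpose 1F 2F) (increasing-rows₃ _ r₁<r₂ r₂<r₀))
  ... | tri> _ _ r₁<r₀ | tri> _ _ r₂<r₁ | _ = reindex (transpose 0F 2F) (increasing-rows₃ _ r₂<r₁ r₁<r₀)

  spanning-cyclable₂ : SpanningCyclable m 4 τ₀ 2
  spanning-cyclable₂ a a-inj with <-cmp (row (a 0F)) (row (a 1F))
  ... | tri< r₀<r₁ _ _ = increasing-rows₂ a r₀<r₁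
  ... | tri> _ _ r₁<r₀ = reindex (transpose 0F 1F) (increasing-rows₂ _ r₁<r₀)
  ... | tri≈ _ r₀≡r₁ _ = same-row₂ a (toℕ-injective r₀≡r₁) (contraInjective a-inj λ ())

  spanning-cyclable₃ : SpanningCyclable m 4 τ₀ 3
  spanning-cyclable₃ a a-inj with row (a 0F) ℕ.≟ row (a 1F) | row (a 0F) ℕ.≟ row (a 2F) | row (a 1F) ℕ.≟ row (a 2F)
  ... | yes r₀≡r₁ | yes r₀≡r₂ | _ = same-row₃ a a-inj r₀≡r₁ r₀≡r₂
  ... | yes r₀≡r₁ | no r₀≢r₂ | _ = pair-and-lone a (contraInjective a-inj λ ()) r₀≡r₁ r₀≢r₂
  ... | no r₀≢r₁ | yes r₀≡r₂ | _ = reindex (transpose 1F 2F) (pair-and-lone _ (contraInjective a-inj λ ()) r₀≡r₂ r₀≢r₁)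
  ... | no r₀≢r₁ | no r₀≢r₂ | yes r₁≡r₂ =
    reindex (transpose 0F 2F) (pair-and-lone _ (contraInjective a-inj λ ()) (sym r₁≡r₂) (r₀≢r₂ ∘ sym))
  ... | no r₀≢r₁ | no r₀≢r₂ | no r₁≢r₂ = distinct-rows₃ a r₀≢r₁ r₀≢r₂ r₁≢r₂

theorem4p1 : ∀ (m : ℕ) → m ≥ 3 → SpanningCyclable m 4 τ₀ 2 × SpanningCyclable m 4 τ₀ 3
theorem4p1 (suc (suc (suc n))) (s≤s (s≤s (s≤s z≤n))) = TwistedTorus.spanning-cyclable₂ n , TwistedTorus.spanning-cyclable₃ n
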